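{- Let $\mathbf{ILX}$ be any logic extending $\mathbf{IL}$, let $\Gamma$ be an $\mathbf{ILX}$-MCS, $B$ a formula and $S$ a set of formulas. If for every finite $S'\subseteq S$ we have $\neg\big(B\rhd\bigvee_{\sigma\in S'}\neg\sigma\big)\in\Gamma$, then there exists an $\mathbf{ILX}$-MCS $\Delta$ such that $\Gamma\prec_S\Delta$ and $B,\Box\neg B\in\Delta$.
   Context: Formulas are built from $\bot$, propositional variables, $\to$, $\Box$ and binary $\rhd$; $\Diamond A:=\neg\Box\neg A$. $\mathbf{IL}$ is axiomatised by classical tautologies, K: $\Box(A\to B)\to(\Box A\to\Box B)$, L: $\Box(\Box A\to A)\to\Box A$, J1: $\Box(A\to B)\to A\rhd B$, J2: $(A\rhd B)\wedge(B\rhd C)\to A\rhd C$, J3: $(A\rhd C)\wedge(B\rhd C)\to A\vee B\rhd C$, J4: $A\rhd B\to(\Diamond A\to\Diamond B)$, J5: $\Diamond A\rhd A$, with modus ponens and necessitation. A logic extending $\mathbf{IL}$ is a superset of $\mathbf{IL}$ closed under these rules. An $\mathbf{ILX}$-MCS is a maximal $\mathbf{ILX}$-consistent set of formulas. For MCSs $\Gamma,\Delta$ and a set $S$: $\Gamma\prec_S\Delta$ iff for every formula $A$ and every finite $S'\subseteq S$, if $\neg A\rhd\bigvee_{\sigma\in S'}\neg\sigma\in\Gamma$ then $A,\Box A\in\Delta$ (empty disjunction is $\bot$). -}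

module Defs where

open import Data.Nat using (ℕ)
open import Data.List using (List; []; _∷_)
open import Data.List.Relation.Unary.All using (All)
open import Data.Product using (Σ; _×_)
open import Data.Sum using (_⊎_)
open import Data.Empty using (⊥)
open import Relation.Nullary using (¬_)
open import Data.Bool using (Bool; true; false; not; _∨_)
open import Relation.Binary.PropositionalEquality using (_≡_)

infixr 6 _⇒_
infix 7 _▷_

data Fm : Set where
  bot : Fm
  var : ℕ → Fm
  _⇒_ : Fm → Fm → Fm
  □_  : Fm → Fm
  _▷_ : Fm → Fm → Fm

~_ : Fm → Fm
~ A = A ⇒ bot

⊤' : Fm
⊤' = ~ bot

_∨'_ : Fm → Fm → Fm
A ∨' B = (~ A) ⇒ B

_∧'_ : Fm → Fm → Fm
A ∧' B = ~ (A ⇒ ~ B)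

◇_ : Fm → Fm
◇ A = ~ (□ (~ A))

⋁neg : List Fm → Fm
⋁neg [] = bot
⋁neg (σ ∷ S') = (~ σ) ∨' ⋁neg S'

-- Classical tautologies: formulas valid under every Boolean valuation
-- where □-formulas and ▷-formulas are treated as atoms.

eval : (Fm → Bool) → Fm → Bool
eval v bot     = false
eval v (var n) = v (var n)
eval v (A ⇒ B) = not (eval v A) ∨ eval v B
eval v (□ A)   = v (□ A)
eval v (A ▷ B) = v (A ▷ B)

Tautology : Fm → Set
Tautology A = (v : Fm → Bool) → eval v A ≡ true

data IL : Fm → Set where
  taut : ∀ {A} → Tautology A → IL A
  axK  : ∀ {A B} → IL (□ (A ⇒ B) ⇒ (□ A ⇒ □ B))
  axL  : ∀ {A} → IL (□ (□ A ⇒ A) ⇒ □ A)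
  axJ1 : ∀ {A B} → IL (□ (A ⇒ B) ⇒ A ▷ B)
  axJ2 : ∀ {A B C} → IL (((A ▷ B) ∧' (B ▷ C)) ⇒ A ▷ C)
  axJ3 : ∀ {A B C} → IL (((A ▷ C) ∧' (B ▷ C)) ⇒ (A ∨' B) ▷ C)
  axJ4 : ∀ {A B} → IL (A ▷ B ⇒ (◇ A ⇒ ◇ B))
  axJ5 : ∀ {A} → IL ((◇ A) ▷ A)
  mp   : ∀ {A B} → IL (A ⇒ B) → IL A → IL B
  nec  : ∀ {A} → IL A → IL (□ A)

record ExtendsIL (X : Fm → Set) : Set where
  field
    contains-IL : ∀ {A} → IL A → X A
    closed-mp   : ∀ {A B} → X (A ⇒ B) → X A → X B
    closed-nec  : ∀ {A} → X A → X (□ A)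

_⇛_ : List Fm → Fm → Fm
[] ⇛ C = C
(A ∷ As) ⇛ C = A ⇒ (As ⇛ C)

Inconsistent : (Fm → Set) → (Fm → Set) → Set
Inconsistent X Γ = Σ (List Fm) (λ As → All Γ As × X (As ⇛ bot))

Consistent : (Fm → Set) → (Fm → Set) → Set
Consistent X Γ = ¬ Inconsistent X Γ

_,,_ : (Fm → Set) → Fm → (Fm → Set)
(Γ ,, A) B = Γ B ⊎ B ≡ A

record MCS (X : Fm → Set) (Γ : Fm → Set) : Set where
  field
    consistent : Consistent X Γ
    maximal    : ∀ A → Consistent X (Γ ,, A) → Γ A

_≺[_]_ : (Fm → Set) → (Fm → Set) → (Fm → Set) → Set
Γ ≺[ S ] Δ = ∀ (A : Fm) (S' : List Fm) → All S S' →
             Γ ((~ A) ▷ ⋁neg S') → Δ A × Δ (□ A)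

module Submission where

-- Call A "S-good in Γ" when ¬A ▷ ⋁¬S' ∈ Γ for some finite S' ⊆ S; these
-- are exactly the formulas that Γ ≺_S Δ forces, together with their boxes,
-- into Δ.  Good formulas are closed under conjunction, so it suffices to
-- show that the seed set
--     Seed = { C : ⊢ W A → C for some good A },  W A = (B ∧ □¬B) ∧ (A ∧ □A)
-- is consistent and to extend it to an MCS by Lindenbaum's lemma.  If the
-- seed were inconsistent, then ⊢ ¬W A for some good A; Löb's axiom gives
-- ⊢ B ▷ (B ∧ □¬B), and J1, J3, J5 turn ⊢ ¬W A into ⊢ (B ∧ □¬B) ▷ ¬A, so
-- B ▷ ¬A ▷ ⋁¬S' puts B ▷ ⋁¬S' in Γ, contradicting the hypothesis.

open import Defs
open import Data.List using (List; []; _∷_; _++_; map; foldl; cartesianProductWith)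
open import Data.List.Relation.Unary.All using (All; []; _∷_)
import Data.List.Relation.Unary.All as All
import Data.List.Relation.Unary.All.Properties as AllP
open import Data.List.Relation.Unary.Any using (here; there)
open import Data.List.Membership.Propositional using (_∈_)
open import Data.List.Membership.Propositional.Properties
  using (∈-++⁺ˡ; ∈-++⁺ʳ; ∈-map⁺; ∈-cartesianProductWith⁺)
open import Data.Product using (Σ; _×_; _,_)
open import Data.Sum using (_⊎_; inj₁; inj₂)
open import Data.Empty using (⊥; ⊥-elim)
open import Data.Nat using (ℕ; zero; suc; _⊔_; _≤_; _≤′_; ≤′-refl; ≤′-step)
open import Data.Nat.Properties using (m≤m⊔n; m≤n⊔m; ≤⇒≤′)
open import Data.Bool using (Bool; true; false; not; _∨_)
open import Relation.Nullary using (¬_)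
open import Relation.Unary using (_⊆_)
open import Relation.Binary.PropositionalEquality using (_≡_; refl)

-- A formula holds under a valuation of its atoms.  (A record, so that
-- the formula can be inferred from the type.)
record Holds (v : Fm → Bool) (A : Fm) : Set where
  constructor holds
  field truth : eval v A ≡ true
open Holds

_⊨_ : List Fm → Fm → Set
Hs ⊨ C = ∀ v → All (Holds v) Hs → Holds v C

module _ {v : Fm → Bool} where

  bot-fails : ¬ Holds v bot
  bot-fails (holds ())

  ⇒-intro : ∀ {A B} → (Holds v A → Holds v B) → Holds v (A ⇒ B)
  ⇒-intro {A} {B} f = holds (implies (eval v A) (eval v B) (λ a → truth (f (holds a))))
    where
      implies : ∀ a b → (a ≡ true → b ≡ true) → not a ∨ b ≡ true
      implies false b f = refl
      implies true  b f = f refl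

  ⇒-elim : ∀ {A B} → Holds v (A ⇒ B) → Holds v A → Holds v B
  ⇒-elim {A} {B} (holds ab) (holds a) = holds (modusPonens (eval v A) (eval v B) ab a)
    where
      modusPonens : ∀ a b → not a ∨ b ≡ true → a ≡ true → b ≡ true
      modusPonens true b h refl = h

  stable : ∀ {A} → ¬ ¬ Holds v A → Holds v A
  stable {A} h = holds (booleanStable (eval v A) (λ na → h (λ a → na (truth a))))
    where
      booleanStable : ∀ b → ¬ ¬ b ≡ true → b ≡ true
      booleanStable true  h = refl
      booleanStable false h = ⊥-elim (h λ ())

  ~-intro : ∀ {A} → (Holds v A → ⊥) → Holds v (~ A)
  ~-intro f = ⇒-intro (λ a → ⊥-elim (f a))

  ~-elim : ∀ {A} → Holds v (~ A) → ¬ Holds v A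
  ~-elim na a = bot-fails (⇒-elim na a)

  ~~-elim : ∀ {A} → Holds v (~ (~ A)) → Holds v A
  ~~-elim nna = stable (λ na → ~-elim nna (~-intro na))

  ∧-intro : ∀ {A B} → Holds v A → Holds v B → Holds v (A ∧' B)
  ∧-intro a b = ~-intro (λ a⇒¬b → ~-elim (⇒-elim a⇒¬b a) b)

  ∧-elimˡ : ∀ {A B} → Holds v (A ∧' B) → Holds v A
  ∧-elimˡ ab = stable (λ na → ~-elim ab (⇒-intro (λ a → ⊥-elim (na a))))

  ∧-elimʳ : ∀ {A B} → Holds v (A ∧' B) → Holds v B
  ∧-elimʳ ab = stable (λ nb → ~-elim ab (⇒-intro (λ _ → ~-intro nb)))

  ⇛-intro : ∀ Cs {D} → (All (Holds v) Cs → Holds v D) → Holds v (Cs ⇛ D)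
  ⇛-intro []       f = f []
  ⇛-intro (C ∷ Cs) f = ⇒-intro (λ c → ⇛-intro Cs (λ cs → f (c ∷ cs)))

  ⇛-elim : ∀ Cs {D} → Holds v (Cs ⇛ D) → All (Holds v) Cs → Holds v D
  ⇛-elim []       d []       = d
  ⇛-elim (C ∷ Cs) d (c ∷ cs) = ⇛-elim Cs (⇒-elim d c) cs

  ⋁neg-intro : ∀ S' → ¬ All (Holds v) S' → Holds v (⋁neg S')
  ⋁neg-intro []      f = ⊥-elim (f [])
  ⋁neg-intro (σ ∷ S') f = ⇒-intro (λ nnσ → ⋁neg-intro S' (λ all → f (~~-elim nnσ ∷ all)))

  ⋁neg-elim : ∀ S' → Holds v (⋁neg S') → ¬ All (Holds v) S'
  ⋁neg-elim []       h []       = bot-fails h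
  ⋁neg-elim (σ ∷ S') h (s ∷ ss) = ⋁neg-elim S' (⇒-elim h (~-intro (λ nσ → ~-elim nσ s))) ss

module Derivations {X : Fm → Set} (ext : ExtendsIL X) where
  open ExtendsIL ext

  mp* : ∀ Hs {C} → X (Hs ⇛ C) → All X Hs → X C
  mp* []       c  []       = c
  mp* (H ∷ Hs) hc (h ∷ hs) = mp* Hs (closed-mp hc h) hs

  tautological : ∀ {Hs C} → Hs ⊨ C → All X Hs → X C
  tautological {Hs} sem = mp* Hs (contains-IL (taut (λ v → truth (⇛-intro Hs (sem v)))))

  ⇒-refl : ∀ {A} → X (A ⇒ A)
  ⇒-refl = tautological (λ v [] → ⇒-intro (λ a → a)) []

  ⇒-weaken : ∀ {P D} → X D → X (P ⇒ D)
  ⇒-weaken d = tautological (λ { v (d ∷ []) → ⇒-intro (λ _ → d) }) (d ∷ [])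

  ⇒-trans : ∀ {A B C} → X (A ⇒ B) → X (B ⇒ C) → X (A ⇒ C)
  ⇒-trans ab bc = tautological
    (λ { v (ab ∷ bc ∷ []) → ⇒-intro (λ a → ⇒-elim bc (⇒-elim ab a)) }) (ab ∷ bc ∷ [])

  ∧-curry : ∀ {A B C} → X ((A ∧' B) ⇒ C) → X (A ⇒ B ⇒ C)
  ∧-curry h = tautological
    (λ { v (h ∷ []) → ⇒-intro (λ a → ⇒-intro (λ b → ⇒-elim h (∧-intro a b))) }) (h ∷ [])

  ⇛-cut : ∀ {P D} Cs → All (λ C → X (P ⇒ C)) Cs → X (P ⇒ (Cs ⇛ D)) → X (P ⇒ D)
  ⇛-cut []       []         h = h
  ⇛-cut (C ∷ Cs) (pc ∷ pcs) h = ⇛-cut Cs pcs (tautological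
    (λ { v (pc ∷ h ∷ []) → ⇒-intro (λ p → ⇒-elim (⇒-elim h p) (⇒-elim pc p)) }) (pc ∷ h ∷ []))

  □-mono : ∀ {A B} → X (A ⇒ B) → X (□ A ⇒ □ B)
  □-mono ab = closed-mp (contains-IL axK) (closed-nec ab)

  J1-rule : ∀ {A B} → X (A ⇒ B) → X (A ▷ B)
  J1-rule ab = closed-mp (contains-IL axJ1) (closed-nec ab)

  J2-rule : ∀ {A B C} → X (A ▷ B) → X (B ▷ C) → X (A ▷ C)
  J2-rule ab bc = closed-mp (closed-mp (∧-curry (contains-IL axJ2)) ab) bc

  J3-rule : ∀ {A B C} → X (A ▷ C) → X (B ▷ C) → X ((A ∨' B) ▷ C)
  J3-rule ac bc = closed-mp (closed-mp (∧-curry (contains-IL axJ3)) ac) bc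

  -- By J5, a formula interprets everything that implies it or its consistency.
  ▷-from-◇ : ∀ {A B} → X (A ⇒ (B ∨' (◇ B))) → X (A ▷ B)
  ▷-from-◇ h = J2-rule (J1-rule h) (J3-rule (J1-rule ⇒-refl) (contains-IL axJ5))

  -- Löb's axiom: every B interprets a "B-minimal" world, where B holds
  -- but nowhere above it.
  ▷-minimal : ∀ B → X (B ▷ (B ∧' (□ (~ B))))
  ▷-minimal B = ▷-from-◇ (tautological
      (λ { v (□¬C⇒□¬B ∷ []) → ⇒-intro (λ b → ⇒-intro (λ ¬C → ~-intro (λ □¬C →
             ~-elim ¬C (∧-intro b (⇒-elim □¬C⇒□¬B □¬C))))) })
      (⇒-trans (□-mono ¬C⇒löb) (contains-IL axL) ∷ []))
    where
      ¬C⇒löb : X (~ (B ∧' (□ (~ B))) ⇒ (□ (~ B) ⇒ ~ B))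
      ¬C⇒löb = tautological
        (λ v [] → ⇒-intro (λ ¬C → ⇒-intro (λ □¬B → ~-intro (λ b → ~-elim ¬C (∧-intro b □¬B))))) []

  -- If C refutes A ∧ □A, then C interprets ¬A (through ◇¬A and J5).
  ▷-from-refutation : ∀ {C A} → X (~ (C ∧' (A ∧' (□ A)))) → X (C ▷ ~ A)
  ▷-from-refutation refuted = ▷-from-◇ (tautological
      (λ { v (refuted ∷ □¬¬A⇒□A ∷ []) → ⇒-intro (λ c → ⇒-intro (λ ¬¬A → ~-intro (λ □¬¬A →
             ~-elim refuted (∧-intro c (∧-intro (~~-elim ¬¬A) (⇒-elim □¬¬A⇒□A □¬¬A)))))) })
      (refuted ∷ □-mono (tautological (λ { v [] → ⇒-intro ~~-elim }) []) ∷ []))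

module MaximalConsistent {X : Fm → Set} (ext : ExtendsIL X)
                         {Γ : Fm → Set} (Γ-mcs : MCS X Γ) where
  open ExtendsIL ext
  open Derivations ext
  open MCS Γ-mcs

  separate : ∀ {C Ps} → All (Γ ,, C) Ps →
             Σ (List Fm) λ Qs → All Γ Qs ×
               (∀ v → Holds v C → All (Holds v) Qs → All (Holds v) Ps)
  separate [] = [] , [] , λ v c qs → []
  separate (inj₁ γ ∷ ps) with separate ps
  ... | Qs , γs , sem = (_ ∷ Qs) , (γ ∷ γs) , λ { v c (q ∷ qs) → q ∷ sem v c qs }
  separate (inj₂ refl ∷ ps) with separate ps
  ... | Qs , γs , sem = Qs , γs , λ v c qs → c ∷ sem v c qs

  derivable∈ : ∀ {C} Rs → All Γ Rs → X (Rs ⇛ C) → Γ C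
  derivable∈ {C} Rs rs derivation = maximal C refuteExtension
    where
      refuteExtension : Consistent X (Γ ,, C)
      refuteExtension (Ps , ps , inconsistent) with separate ps
      ... | Qs , qs , sem = consistent ((Qs ++ Rs) , AllP.++⁺ qs rs , tautological
        (λ { v (inconsistent ∷ derivation ∷ []) → ⇛-intro (Qs ++ Rs) (λ qrs →
               ⇛-elim Ps inconsistent
                 (sem v (⇛-elim Rs derivation (AllP.++⁻ʳ Qs qrs)) (AllP.++⁻ˡ Qs qrs))) })
        (inconsistent ∷ derivation ∷ []))

  theorem∈ : ∀ {C} → X C → Γ C
  theorem∈ = derivable∈ [] []

  ▷-trans∈ : ∀ {A B C} → Γ (A ▷ B) → Γ (B ▷ C) → Γ (A ▷ C)
  ▷-trans∈ ab bc = derivable∈ (_ ∷ _ ∷ []) (ab ∷ bc ∷ []) (∧-curry (contains-IL axJ2))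

  ▷-∨∈ : ∀ {A B C} → Γ (A ▷ C) → Γ (B ▷ C) → Γ ((A ∨' B) ▷ C)
  ▷-∨∈ ac bc = derivable∈ (_ ∷ _ ∷ []) (ac ∷ bc ∷ []) (∧-curry (contains-IL axJ3))

  not-both : ∀ {C} → Γ C → Γ (~ C) → ⊥
  not-both {C} c ¬c = consistent ((C ∷ ~ C ∷ []) , (c ∷ ¬c ∷ []) ,
    tautological (λ v [] → ⇒-intro (λ c → ⇒-intro (λ ¬c → ⊥-elim (~-elim ¬c c)))) [])

Increasing : {A : Set} → (ℕ → A → Set) → Set
Increasing F = ∀ k → F k ⊆ F (suc k)

increasing-≤′ : ∀ {A : Set} {F : ℕ → A → Set} → Increasing F → ∀ {k j} → k ≤′ j → F k ⊆ F j
increasing-≤′ inc ≤′-refl      x = x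
increasing-≤′ inc (≤′-step k≤j) x = inc _ (increasing-≤′ inc k≤j x)

increasing-≤ : ∀ {A : Set} {F : ℕ → A → Set} → Increasing F → ∀ {k j} → k ≤ j → F k ⊆ F j
increasing-≤ inc k≤j = increasing-≤′ inc (≤⇒≤′ k≤j)

⋃ : {A : Set} → (ℕ → A → Set) → A → Set
⋃ F x = Σ ℕ λ k → F k x

finite-in-stage : ∀ {A : Set} {F : ℕ → A → Set} → Increasing F →
                  ∀ {xs} → All (⋃ F) xs → Σ ℕ λ k → All (F k) xs
finite-in-stage inc [] = zero , []
finite-in-stage inc ((i , x) ∷ xs) with finite-in-stage inc xs
... | j , ys = i ⊔ j , increasing-≤ inc (m≤m⊔n i j) x ∷ All.map (increasing-≤ inc (m≤n⊔m i j)) ys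

buildOn : List Fm → List Fm
buildOn E = cartesianProductWith _⇒_ E E ++ map □_ E ++ cartesianProductWith _▷_ E E

formulasUpTo : ℕ → List Fm
formulasUpTo zero    = []
formulasUpTo (suc k) = formulasUpTo k ++ bot ∷ var k ∷ buildOn (formulasUpTo k)

formulasUpTo-increasing : Increasing (λ k A → A ∈ formulasUpTo k)
formulasUpTo-increasing k = ∈-++⁺ˡ

new∈ : ∀ {k A} → A ∈ buildOn (formulasUpTo k) → A ∈ formulasUpTo (suc k)
new∈ {k} a = ∈-++⁺ʳ (formulasUpTo k) (there (there a))

common-layer : ∀ A B → Σ ℕ (λ i → A ∈ formulasUpTo i) → Σ ℕ (λ j → B ∈ formulasUpTo j) →
               Σ ℕ λ k → A ∈ formulasUpTo k × B ∈ formulasUpTo k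
common-layer A B (i , a) (j , b) =
  i ⊔ j , increasing-≤ formulasUpTo-increasing (m≤m⊔n i j) a
        , increasing-≤ formulasUpTo-increasing (m≤n⊔m i j) b

enumerated : ∀ A → Σ ℕ λ k → A ∈ formulasUpTo k
enumerated bot     = 1 , here refl
enumerated (var n) = suc n , ∈-++⁺ʳ (formulasUpTo n) (there (here refl))
enumerated (A ⇒ B) with common-layer A B (enumerated A) (enumerated B)
... | k , a , b = suc k , new∈ (∈-++⁺ˡ (∈-cartesianProductWith⁺ _⇒_ a b))
enumerated (□ A) with enumerated A
... | k , a = suc k , new∈ (∈-++⁺ʳ (cartesianProductWith _⇒_ (formulasUpTo k) (formulasUpTo k))
                            (∈-++⁺ˡ (∈-map⁺ □_ a)))
enumerated (A ▷ B) with common-layer A B (enumerated A) (enumerated B)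
... | k , a , b = suc k , new∈ (∈-++⁺ʳ (cartesianProductWith _⇒_ (formulasUpTo k) (formulasUpTo k))
                                (∈-++⁺ʳ (map □_ (formulasUpTo k)) (∈-cartesianProductWith⁺ _▷_ a b)))

module Lindenbaum (X : Fm → Set) where

  consistent-⊆ : ∀ {Θ Θ′ : Fm → Set} → Θ ⊆ Θ′ → Consistent X Θ′ → Consistent X Θ
  consistent-⊆ Θ⊆Θ′ c (Ps , ps , inconsistent) = c (Ps , All.map Θ⊆Θ′ ps , inconsistent)

  -- Add A to Θ if that keeps Θ consistent (no decision procedure is needed:
  -- the consistency proof is recorded as part of the membership evidence).
  _⊕_ : (Fm → Set) → Fm → (Fm → Set)
  (Θ ⊕ A) C = Θ C ⊎ (C ≡ A × Consistent X (Θ ,, A))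

  old-or-added : ∀ {Θ A Qs} → All (Θ ⊕ A) Qs → All Θ Qs ⊎ Consistent X (Θ ,, A)
  old-or-added [] = inj₁ []
  old-or-added (inj₂ (_ , c) ∷ qs) = inj₂ c
  old-or-added (inj₁ θ ∷ qs) with old-or-added qs
  ... | inj₁ θs = inj₁ (θ ∷ θs)
  ... | inj₂ c  = inj₂ c

  ⊕-⊆-,, : ∀ {Θ A} → Θ ⊕ A ⊆ Θ ,, A
  ⊕-⊆-,, (inj₁ θ)          = inj₁ θ
  ⊕-⊆-,, (inj₂ (refl , _)) = inj₂ refl

  ⊕-consistent : ∀ {Θ} A → Consistent X Θ → Consistent X (Θ ⊕ A)
  ⊕-consistent A c (Ps , ps , inconsistent) with old-or-added ps
  ... | inj₁ θs    = c (Ps , θs , inconsistent)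
  ... | inj₂ added = added (Ps , All.map ⊕-⊆-,, ps , inconsistent)

  ⊕* : (Fm → Set) → List Fm → (Fm → Set)
  ⊕* = foldl _⊕_

  ⊕*-⊇ : ∀ {Θ} As → Θ ⊆ ⊕* Θ As
  ⊕*-⊇ []       θ = θ
  ⊕*-⊇ (A ∷ As) θ = ⊕*-⊇ As (inj₁ θ)

  ⊕*-consistent : ∀ {Θ} As → Consistent X Θ → Consistent X (⊕* Θ As)
  ⊕*-consistent []       c = c
  ⊕*-consistent (A ∷ As) c = ⊕*-consistent As (⊕-consistent A c)

  ⊕*-decides : ∀ {Θ Δ A} As → A ∈ As → ⊕* Θ As ⊆ Δ → Consistent X (Δ ,, A) → ⊕* Θ As A
  ⊕*-decides {Θ} {Δ} (A ∷ As) (here refl) result⊆Δ c =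
    ⊕*-⊇ As (inj₂ (refl , consistent-⊆ Θ,,A⊆Δ,,A c))
    where
      Θ,,A⊆Δ,,A : Θ ,, A ⊆ Δ ,, A
      Θ,,A⊆Δ,,A (inj₁ θ) = inj₁ (result⊆Δ (⊕*-⊇ As (inj₁ θ)))
      Θ,,A⊆Δ,,A (inj₂ e) = inj₂ e
  ⊕*-decides (A′ ∷ As) (there a) result⊆Δ c = ⊕*-decides As a result⊆Δ c

  stage : (Fm → Set) → ℕ → (Fm → Set)
  stage Θ zero    = Θ
  stage Θ (suc k) = ⊕* (stage Θ k) (formulasUpTo k)

  lindenbaum : ∀ {Θ} → Consistent X Θ → Σ (Fm → Set) λ Δ → MCS X Δ × Θ ⊆ Δ
  lindenbaum {Θ} c = ⋃ (stage Θ) , mcs , (λ θ → zero , θ)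
    where
      increasing : Increasing (stage Θ)
      increasing k = ⊕*-⊇ (formulasUpTo k)

      stage-consistent : ∀ k → Consistent X (stage Θ k)
      stage-consistent zero    = c
      stage-consistent (suc k) = ⊕*-consistent (formulasUpTo k) (stage-consistent k)

      mcs : MCS X (⋃ (stage Θ))
      mcs = record { consistent = consistent ; maximal = maximal }
        where
          consistent : Consistent X (⋃ (stage Θ))
          consistent (Ps , ps , inconsistent) =
            let (k , ps′) = finite-in-stage increasing ps
            in  stage-consistent k (Ps , ps′ , inconsistent)

          -- A is added at the stage that processes the layer containing it.
          maximal : ∀ A → Consistent X (⋃ (stage Θ) ,, A) → ⋃ (stage Θ) A
          maximal A c′ with enumerated A
          ... | k , a = suc k , ⊕*-decides (formulasUpTo k) a (λ x → suc k , x) c′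

module CriticalSuccessor {X : Fm → Set} (ext : ExtendsIL X)
                         {Γ : Fm → Set} (Γ-mcs : MCS X Γ) (S : Fm → Set) where
  open Derivations ext
  open MaximalConsistent ext Γ-mcs

  Good : Fm → Set
  Good A = Σ (List Fm) λ S' → All S S' × Γ ((~ A) ▷ ⋁neg S')

  good-⊤ : Good ⊤'
  good-⊤ = [] , [] , theorem∈ (J1-rule (tautological (λ v [] → ⇒-intro ~~-elim) []))

  good-∧ : ∀ {A A′} → Good A → Good A′ → Good (A ∧' A′)
  good-∧ {A} {A′} (S₁ , S₁⊆S , g₁) (S₂ , S₂⊆S , g₂) =
    S₁ ++ S₂ , AllP.++⁺ S₁⊆S S₂⊆S ,
    ▷-trans∈ (theorem∈ (J1-rule deMorgan))
             (▷-∨∈ (▷-trans∈ g₁ (theorem∈ (J1-rule (⋁neg-++ (λ v → AllP.++⁻ˡ S₁)))))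
                   (▷-trans∈ g₂ (theorem∈ (J1-rule (⋁neg-++ (λ v → AllP.++⁻ʳ S₁))))))
    where
      deMorgan : X (~ (A ∧' A′) ⇒ ((~ A) ∨' (~ A′)))
      deMorgan = tautological (λ v [] → ⇒-intro (λ ¬A∧A′ → ⇒-intro (λ ¬¬A → ~-intro (λ a′ →
        ~-elim ¬A∧A′ (∧-intro (~~-elim ¬¬A) a′))))) []

      ⋁neg-++ : ∀ {T} → (∀ v → All (Holds v) (S₁ ++ S₂) → All (Holds v) T) →
                X (⋁neg T ⇒ ⋁neg (S₁ ++ S₂))
      ⋁neg-++ {T} restrict = tautological (λ v [] → ⇒-intro (λ t →
        ⋁neg-intro (S₁ ++ S₂) (λ all → ⋁neg-elim T t (restrict v all)))) []

  module _ (B : Fm) where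

    W : Fm → Fm
    W A = (B ∧' (□ (~ B))) ∧' (A ∧' (□ A))

    W-mono : ∀ {A A′} → X (A ⇒ A′) → X (W A ⇒ W A′)
    W-mono aa′ = tautological
      (λ { v (aa′ ∷ □aa′ ∷ []) → ⇒-intro (λ w → ∧-intro (∧-elimˡ w)
             (∧-intro (⇒-elim aa′ (∧-elimˡ (∧-elimʳ w))) (⇒-elim □aa′ (∧-elimʳ (∧-elimʳ w))))) })
      (aa′ ∷ □-mono aa′ ∷ [])

    Seed : Fm → Set
    Seed C = Σ Fm λ A → Good A × X (W A ⇒ C)

    seed-B : Seed B
    seed-B = ⊤' , good-⊤ , tautological (λ v [] → ⇒-intro (λ w → ∧-elimˡ (∧-elimˡ w))) []

    seed-□¬B : Seed (□ (~ B))
    seed-□¬B = ⊤' , good-⊤ , tautological (λ v [] → ⇒-intro (λ w → ∧-elimʳ (∧-elimˡ w))) []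

    seed-A : ∀ {A} → Good A → Seed A
    seed-A g = _ , g , tautological (λ v [] → ⇒-intro (λ w → ∧-elimˡ (∧-elimʳ w))) []

    seed-□A : ∀ {A} → Good A → Seed (□ A)
    seed-□A g = _ , g , tautological (λ v [] → ⇒-intro (λ w → ∧-elimʳ (∧-elimʳ w))) []

    seed-finite : ∀ {Cs} → All Seed Cs → Σ Fm λ A → Good A × All (λ C → X (W A ⇒ C)) Cs
    seed-finite [] = ⊤' , good-⊤ , []
    seed-finite ((A , g , h) ∷ seeds) with seed-finite seeds
    ... | A′ , g′ , hs = (A ∧' A′) , good-∧ g g′ ,
      ⇒-trans (W-mono (tautological (λ v [] → ⇒-intro ∧-elimˡ) [])) h ∷
      All.map (⇒-trans (W-mono (tautological (λ v [] → ⇒-intro ∧-elimʳ) []))) hs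

    seed-consistent : ((S' : List Fm) → All S S' → Γ (~ (B ▷ ⋁neg S'))) → Consistent X Seed
    seed-consistent hyp (Cs , seeds , inconsistent) with seed-finite seeds
    ... | A , (S' , S'⊆S , ¬A▷S') , consequences =
      not-both (▷-trans∈ (theorem∈ B▷¬A) ¬A▷S') (hyp S' S'⊆S)
      where
        B▷¬A : X (B ▷ ~ A)
        B▷¬A = J2-rule (▷-minimal B)
                       (▷-from-refutation (⇛-cut Cs consequences (⇒-weaken inconsistent)))

    seed-extension-succeeds : ∀ {Δ} → Seed ⊆ Δ → Γ ≺[ S ] Δ × Δ B × Δ (□ (~ B))
    seed-extension-succeeds {Δ} seed⊆Δ = successor , seed⊆Δ seed-B , seed⊆Δ seed-□¬B
      where
        successor : Γ ≺[ S ] Δ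
        successor A S' S'⊆S ¬A▷S' = seed⊆Δ (seed-A good) , seed⊆Δ (seed-□A good)
          where
            good : Good A
            good = S' , S'⊆S , ¬A▷S'


theorem5p2 : (X : Fm → Set) → ExtendsIL X →
             (Γ : Fm → Set) → MCS X Γ →
             (B : Fm) (S : Fm → Set) →
             ((S' : List Fm) → All S S' → Γ (~ (B ▷ ⋁neg S'))) →
             Σ (Fm → Set) (λ Δ → MCS X Δ × Γ ≺[ S ] Δ × Δ B × Δ (□ (~ B)))
theorem5p2 X ext Γ Γ-mcs B S hyp =
  let (Δ , Δ-mcs , seed⊆Δ) = Lindenbaum.lindenbaum X (seed-consistent B hyp)
  in  Δ , Δ-mcs , seed-extension-succeeds B seed⊆Δ
  where open CriticalSuccessor ext Γ-mcs S
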